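{- Let $p,q\ge3$ be integers with $(p-2)(q-2)>4$ and let $h\ge1$ be an integer. Then the function $n\mapsto M_{p,q}(n,h)$ is nondecreasing on the positive integers.
   Context: The $\{p,q\}$-tessellation is the regular tiling of the hyperbolic plane by congruent regular $p$-gons (tiles), $q$ meeting at each vertex. A $\{p,q\}$-polyform is a finite nonempty collection of tiles whose union has connected interior. The perimeter of a polyform is the number of edges of its tiles belonging to exactly one of its tiles; $P_{\min}^{p,q}(N)$ is the minimum perimeter over all $\{p,q\}$-polyforms with $N$ tiles. Define $M_{p,q}(n,h)=\frac{n(p-2)+2-P_{\min}^{p,q}(n+h)}{p}$. -}

module Defs where

open import Data.Nat using (ℕ; zero; suc; _+_; _*_; _∸_; _≤_; _<_; z≤n; s≤s; >-nonZero)
open import Data.Nat.Properties using (≤-trans)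
open import Data.Integer using (ℤ; +_) renaming (_-_ to _-ℤ_)
open import Data.Rational using (ℚ; _/_)
open import Data.Bool using (Bool; true; false; if_then_else_)
open import Data.Fin using (Fin; toℕ)
open import Data.List using (List; []; _∷_; _++_; replicate; length; lookup; map; allFin)
open import Data.Nat.ListAction using (sum)
open import Data.List.Relation.Unary.AllPairs using (AllPairs)
open import Data.Product using (Σ; ∃; _×_; _,_)
open import Data.Sum using (_⊎_)
open import Relation.Nullary using (¬_)
open import Relation.Binary.PropositionalEquality using (_≡_; _≢_)
open import Function.Bundles using (_⇔_)

-- The {p,q}-tessellation, modelled via its orientation-preserving
-- symmetry group, the von Dyck group
--   G(p,q) = ⟨ a , b ∣ a^p = b^q = (ab)^2 = 1 ⟩
-- where a is the rotation by 2π/p about the centre of a base tile T₀,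
-- b the rotation by 2π/q about a vertex of T₀, and ab the half-turn
-- about the midpoint of an edge e₀ of T₀.  G acts simply transitively
-- on flags-up-to-reflection, and:
--   tiles  ↔ left cosets g⟨a⟩     (tile g·T₀),
--   edges  ↔ left cosets g⟨ab⟩    (edge g·e₀),
--   the edges of tile g·T₀ are g aⁱ·e₀ (i = 0 … p-1).
-- Since every generator has finite order, G is presented as a monoid
-- on positive words in a, b.

data Gen : Set where
  𝐚 𝐛 : Gen

Word : Set
Word = List Gen

data Relator (p q : ℕ) : Word → Set where
  rel-a  : Relator p q (replicate p 𝐚)
  rel-b  : Relator p q (replicate q 𝐛)
  rel-ab : Relator p q (𝐚 ∷ 𝐛 ∷ 𝐚 ∷ 𝐛 ∷ [])

data _≈⟨_,_⟩_ : Word → ℕ → ℕ → Word → Set where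
  ≈-rel   : ∀ {p q} u r v → Relator p q r → (u ++ r ++ v) ≈⟨ p , q ⟩ (u ++ v)
  ≈-refl  : ∀ {p q w} → w ≈⟨ p , q ⟩ w
  ≈-sym   : ∀ {p q u v} → u ≈⟨ p , q ⟩ v → v ≈⟨ p , q ⟩ u
  ≈-trans : ∀ {p q u v w} → u ≈⟨ p , q ⟩ v → v ≈⟨ p , q ⟩ w → u ≈⟨ p , q ⟩ w

Tile : Set
Tile = Word

SameTile : ℕ → ℕ → Tile → Tile → Set
SameTile p q g g' = ∃ λ k → g' ≈⟨ p , q ⟩ (g ++ replicate k 𝐚)

-- edges are represented by group elements g (standing for the edge g·e₀);
-- same edge: g⟨ab⟩ = g'⟨ab⟩, and ⟨ab⟩ = {1, ab}
SameEdge : ℕ → ℕ → Word → Word → Set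
SameEdge p q g g' = (g' ≈⟨ p , q ⟩ g) ⊎ (g' ≈⟨ p , q ⟩ (g ++ 𝐚 ∷ 𝐛 ∷ []))

edgeOf : Tile → ℕ → Word
edgeOf g i = g ++ replicate i 𝐚

Contains : ℕ → ℕ → Tile → Word → Set
Contains p q g e = ∃ λ i → i < p × SameEdge p q (edgeOf g i) e

Adjacent : ℕ → ℕ → Tile → Tile → Set
Adjacent p q g g' = ∃ λ i → i < p × Contains p q g' (edgeOf g i)

-- Polyforms: a finite nonempty list of pairwise distinct tiles whose
-- union has connected interior, i.e. whose edge-adjacency graph is
-- connected.

module _ (p q : ℕ) (L : List Tile) where
  data Reach : Fin (length L) → Fin (length L) → Set where
    reach-refl : ∀ {s} → Reach s s
    reach-step : ∀ {s t u} → Reach s t → Adjacent p q (lookup L t) (lookup L u) → Reach s u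

record Polyform (p q : ℕ) : Set where
  field
    tiles     : List Tile
    nonempty  : 0 < length tiles
    distinct  : AllPairs (λ g g' → ¬ SameTile p q g g') tiles
    connected : ∀ s t → Reach p q tiles s t

open Polyform public

size : ∀ {p q} → Polyform p q → ℕ
size P = length (tiles P)

OnBoundary : ∀ {p q} (P : Polyform p q) → Fin (length (tiles P)) → Fin p → Set
OnBoundary {p} {q} P t i =
  ∀ t' → t' ≢ t → ¬ Contains p q (lookup (tiles P) t') (edgeOf (lookup (tiles P) t) (toℕ i))

countTrue : ∀ {m n} → (Fin m → Fin n → Bool) → ℕ
countTrue {m} {n} f =
  sum (map (λ t → sum (map (λ i → if f t i then 1 else 0) (allFin n))) (allFin m))

-- the perimeter of P is k: k is the number of (tile, side) boundary
-- incidences, i.e. the number of edges belonging to exactly one tile of P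
HasPerimeter : ∀ {p q} → Polyform p q → ℕ → Set
HasPerimeter {p} P k =
  Σ (Fin (length (tiles P)) → Fin p → Bool) λ f →
    (∀ t i → (f t i ≡ true) ⇔ OnBoundary P t i) × countTrue f ≡ k

IsPmin : ℕ → ℕ → ℕ → ℕ → Set
IsPmin p q N P =
  (∃ λ (X : Polyform p q) → size X ≡ N × HasPerimeter X P) ×
  (∀ (X : Polyform p q) k → size X ≡ N → HasPerimeter X k → P ≤ k)

-- M_{p,q}(n,h) = (n(p-2) + 2 - P_min(n+h)) / p, given Pm = P_min(n+h)
M : (p : ℕ) → 3 ≤ p → (n Pm : ℕ) → ℚ
M p 3≤p n Pm = _/_ ((+ (n * (p ∸ 2) + 2)) -ℤ (+ Pm)) p {{>-nonZero (≤-trans (s≤s z≤n) 3≤p)}}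

{-# OPTIONS --safe #-}
-- Writing N = m + h, it suffices to show P_min(N + d) ≤ P_min(N) + d(p - 2).  Start from a
-- minimal polyform of size N and glue on, d times, the tile across some boundary edge: the new
-- tile shares at least one side with the old polyform and turns at least one boundary side of it
-- into an interior one, so the perimeter grows by at most (p - 1) - 1 = p - 2.  A boundary edge
-- exists as long as the polyform is smaller than some other polyform: a polyform without boundary
-- is closed under crossing edges, hence contains every tile, hence is at least as large as any
-- other polyform (pigeonhole).  The hypotheses m, h ≥ 1 serve only to make N ≥ 2, which rules
-- out that the tile across an edge is the tile itself (𝐛 would then be a power of 𝐚 and all tiles
-- would coincide).
--
-- Being on the boundary is not decidable here (it would need a solution of the word problem of
-- the von Dyck group), so perimeters and boundary edges are only obtained under a double
-- negation; this is harmless because the conclusion is a decidable inequality.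
module Submission where

open import Defs
open import Data.Bool using (Bool; true; false; if_then_else_)
open import Data.Bool.Properties using (¬-not)
open import Data.Empty using (⊥-elim)
open import Data.Fin using (Fin; zero; suc; toℕ; fromℕ<)
import Data.Fin.Properties as Fin
open import Data.List using (List; []; _∷_; _++_; [_]; replicate; length; lookup; map; allFin)
open import Data.List.Properties using (++-assoc; ++-identityʳ; map-tabulate; tabulate-lookup)
open import Data.List.Relation.Unary.All as All using (All; _∷_)
open import Data.List.Membership.Propositional.Properties using (∈-lookup)
open import Data.List.Relation.Unary.All.Properties using (tabulate⁺)
open import Data.List.Relation.Unary.AllPairs using (AllPairs; _∷_)
open import Data.Nat using (ℕ; zero; suc; pred; _+_; _*_; _∸_; _≤_; _<_; _≤?_; z≤n; s≤s; NonZero; >-nonZero; >-nonZero⁻¹)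
import Data.Nat.Properties as ℕ
open import Data.Nat.DivMod using (_%_; _/_; m%n<n; m≡m%n+[m/n]*n)
open import Data.Nat.ListAction using (sum)
open import Data.Nat.Tactic.RingSolver using (solve-∀)
open import Data.Integer as ℤ using (+_; +≤+)
import Data.Integer.Properties as ℤ
open import Data.Integer.Tactic.RingSolver renaming (solve-∀ to ℤ-solve-∀)
open import Data.Product using (Σ; ∃; _×_; _,_; proj₁; proj₂)
import Data.Rational as ℚ
open import Data.Rational using () renaming (_≤_ to _≤ℚ_)
import Data.Rational.Properties as ℚ
open import Data.Rational.Unnormalised using (mkℚᵘ; *≤*)
import Data.Rational.Unnormalised.Properties as ℚᵘ
open import Data.Sum using (inj₁; inj₂)
open import Effect.Monad using (RawMonad)
open import Function using (_∘_)
open import Function.Bundles using (_⇔_; mk⇔; Equivalence)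
open import Level using (0ℓ)
open import Relation.Binary.Definitions using (tri<; tri≈; tri>)
open import Relation.Binary.Bundles using (Setoid)
import Relation.Binary.Reasoning.Setoid as ≈-Reasoning
open import Relation.Binary.PropositionalEquality using (_≡_; _≢_; refl; sym; trans; cong; cong₂; subst; subst₂)
open import Relation.Nullary using (¬_; Dec; yes; no)
open import Relation.Nullary.Decidable using (isYes; ¬¬-excluded-middle; decidable-stable)
open import Relation.Nullary.Negation using (¬¬-Monad)

open RawMonad (¬¬-Monad {0ℓ}) using (_>>=_; _<$>_; pure; rawApplicative)

¬¬-Π : ∀ {n} {P : Fin n → Set} → (∀ i → ¬ ¬ P i) → ¬ ¬ (∀ i → P i)
¬¬-Π = Fin.sequence rawApplicative

isYes-⇔ : ∀ {A : Set} (a? : Dec A) → (isYes a? ≡ true) ⇔ A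
isYes-⇔ (yes a) = mk⇔ (λ _ → a) (λ _ → refl)
isYes-⇔ (no ¬a) = mk⇔ (λ ()) (λ a → ⊥-elim (¬a a))

false-of-¬ : ∀ {A : Set} {b} → (b ≡ true) ⇔ A → ¬ A → b ≡ false
false-of-¬ b⇔A ¬A = ¬-not (¬A ∘ Equivalence.to b⇔A)

¬¬-characteristic : ∀ {m n} (P : Fin m → Fin n → Set) →
  ¬ ¬ (Σ (Fin m → Fin n → Bool) λ f → ∀ t i → (f t i ≡ true) ⇔ P t i)
¬¬-characteristic P = do
  P? ← ¬¬-Π λ t → ¬¬-Π λ i → ¬¬-excluded-middle
  pure ((λ t i → isYes (P? t i)) , λ t i → isYes-⇔ (P? t i))

∑ : ∀ n → (Fin n → ℕ) → ℕ
∑ n g = sum (map g (allFin n))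

∑-suc : ∀ {n} (g : Fin (suc n) → ℕ) → ∑ (suc n) g ≡ g zero + ∑ n (g ∘ suc)
∑-suc g = cong (λ xs → g zero + sum xs)
  (trans (map-tabulate suc g) (sym (map-tabulate (λ i → i) (g ∘ suc))))

∑-mono-≤ : ∀ {n} {g h : Fin n → ℕ} → (∀ i → g i ≤ h i) → ∑ n g ≤ ∑ n h
∑-mono-≤ {zero} g≤h = z≤n
∑-mono-≤ {suc n} {g} {h} g≤h rewrite ∑-suc g | ∑-suc h =
  ℕ.+-mono-≤ (g≤h zero) (∑-mono-≤ (g≤h ∘ suc))

∑-mono-< : ∀ {n} {g h : Fin n → ℕ} → (∀ i → g i ≤ h i) → ∀ i → g i < h i → ∑ n g < ∑ n h
∑-mono-< {suc n} {g} {h} g≤h i g<h rewrite ∑-suc g | ∑-suc h with i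
... | zero  = ℕ.+-mono-<-≤ g<h (∑-mono-≤ (g≤h ∘ suc))
... | suc i = ℕ.+-mono-≤-< (g≤h zero) (∑-mono-< (g≤h ∘ suc) i g<h)

∑-const-1 : ∀ n → ∑ n (λ _ → 1) ≡ n
∑-const-1 zero    = refl
∑-const-1 (suc n) = trans (∑-suc {n} (λ _ → 1)) (cong suc (∑-const-1 n))

count : ∀ {n} → (Fin n → Bool) → ℕ
count {n} r = ∑ n (λ i → if r i then 1 else 0)

if-mono-≤ : ∀ {b c : Bool} → (b ≡ true → c ≡ true) → (if b then 1 else 0) ≤ (if c then 1 else 0)
if-mono-≤ {false}         _   = z≤n
if-mono-≤ {true}  {true}  _   = s≤s z≤n
if-mono-≤ {true}  {false} b⇒c with b⇒c refl
... | ()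

count-<-length : ∀ {n} (r : Fin n → Bool) i → r i ≡ false → count r < n
count-<-length {n} r i rᵢ≡false = subst (count r <_) (∑-const-1 n)
  (∑-mono-< (λ j → if-mono-≤ (λ _ → refl)) i (subst (λ b → (if b then 1 else 0) < 1) (sym rᵢ≡false) (s≤s z≤n)))

count-mono-< : ∀ {n} {r s : Fin n → Bool} → (∀ i → r i ≡ true → s i ≡ true) →
  ∀ i → r i ≡ false → s i ≡ true → count r < count s
count-mono-< r⇒s i rᵢ≡false sᵢ≡true = ∑-mono-< (λ j → if-mono-≤ (r⇒s j)) i
  (subst₂ (λ b c → (if b then 1 else 0) < (if c then 1 else 0)) (sym rᵢ≡false) (sym sᵢ≡true) (s≤s z≤n))

countTrue-suc : ∀ {m n} (f : Fin (suc m) → Fin n → Bool) → countTrue f ≡ count (f zero) + countTrue (f ∘ suc)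
countTrue-suc f = ∑-suc (count ∘ f)

countTrue-mono-< : ∀ {m n} {f g : Fin m → Fin n → Bool} → (∀ t i → f t i ≡ true → g t i ≡ true) →
  ∀ t i → f t i ≡ false → g t i ≡ true → countTrue f < countTrue g
countTrue-mono-< f⇒g t i fₜᵢ≡false gₜᵢ≡true = ∑-mono-<
  (λ u → ∑-mono-≤ (λ j → if-mono-≤ (f⇒g u j))) t (count-mono-< (f⇒g t) i fₜᵢ≡false gₜᵢ≡true)

module _ {A : Set} {R : A → A → Set} where

  AllPairs-lookup : ∀ {xs} → AllPairs R xs → ∀ {i j : Fin (length xs)} → toℕ i < toℕ j → R (lookup xs i) (lookup xs j)
  AllPairs-lookup (Rx ∷ _)   {zero}  {suc j} _         = All.lookup Rx (∈-lookup j)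
  AllPairs-lookup (_ ∷ Rxs) {suc i} {suc j} (s≤s i<j) = AllPairs-lookup Rxs i<j

  AllPairs-¬⇒¬total : ∀ {xs} → AllPairs (λ x y → ¬ R x y) xs → 2 ≤ length xs → ¬ (∀ x y → R x y)
  AllPairs-¬⇒¬total ((¬Rx₀x₁ ∷ _) ∷ _) (s≤s (s≤s z≤n)) total = ¬Rx₀x₁ (total _ _)

replicate-+ : ∀ {A : Set} m n (x : A) → replicate (m + n) x ≡ replicate m x ++ replicate n x
replicate-+ zero    n x = refl
replicate-+ (suc m) n x = cong (x ∷_) (replicate-+ m n x)

replicate-∷ʳ : ∀ {A : Set} n (x : A) → replicate n x ++ [ x ] ≡ x ∷ replicate n x
replicate-∷ʳ zero    x = refl
replicate-∷ʳ (suc n) x = cong (x ∷_) (replicate-∷ʳ n x)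

module _ {p q : ℕ} {L : List Tile} where

  Reach-trans : ∀ {s t u} → Reach p q L s t → Reach p q L t u → Reach p q L s u
  Reach-trans s⇝t reach-refl           = s⇝t
  Reach-trans s⇝t (reach-step t⇝u adj) = reach-step (Reach-trans s⇝t t⇝u) adj

  Reach-∷ : ∀ {y s u} → Reach p q L s u → Reach p q (y ∷ L) (suc s) (suc u)
  Reach-∷ reach-refl           = reach-refl
  Reach-∷ (reach-step s⇝t adj) = reach-step (Reach-∷ s⇝t) adj

¬¬-hasPerimeter : ∀ {p q} (X : Polyform p q) → ¬ ¬ ∃ (HasPerimeter X)
¬¬-hasPerimeter X = (λ (f , f⇔) → countTrue f , f , f⇔ , refl) <$> ¬¬-characteristic (OnBoundary X)

+2≤-accumulate : ∀ p k {a b c} → a + 2 ≤ p + b → b + k * 2 ≤ k * p + c → a + suc k * 2 ≤ suc k * p + c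
+2≤-accumulate p k {a} {b} {c} a-bound b-bound = begin
  a + (2 + k * 2)   ≡⟨ ℕ.+-assoc a 2 (k * 2) ⟨
  a + 2 + k * 2     ≤⟨ ℕ.+-monoˡ-≤ (k * 2) a-bound ⟩
  p + b + k * 2     ≡⟨ ℕ.+-assoc p b (k * 2) ⟩
  p + (b + k * 2)   ≤⟨ ℕ.+-monoʳ-≤ p b-bound ⟩
  p + (k * p + c)   ≡⟨ ℕ.+-assoc p (k * p) c ⟨
  p + k * p + c     ∎
  where open ℕ.≤-Reasoning

module VonDyck (p q : ℕ) .{{_ : NonZero p}} .{{_ : NonZero q}} where

  infix 4 _≈_
  _≈_ : Word → Word → Set
  u ≈ v = u ≈⟨ p , q ⟩ v

  ≈-reflexive : ∀ {u v} → u ≡ v → u ≈ v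
  ≈-reflexive refl = ≈-refl

  ≈-setoid : Setoid 0ℓ 0ℓ
  ≈-setoid = record
    { Carrier       = Word
    ; _≈_           = _≈_
    ; isEquivalence = record { refl = ≈-refl ; sym = ≈-sym ; trans = ≈-trans }
    }

  open ≈-Reasoning ≈-setoid

  ++-congʳ : ∀ {u u'} v → u ≈ u' → u ++ v ≈ u' ++ v
  ++-congʳ v (≈-rel x r y R) = subst₂ _≈_
    (sym (trans (++-assoc x (r ++ y) v) (cong (x ++_) (++-assoc r y v))))
    (sym (++-assoc x y v))
    (≈-rel x r (y ++ v) R)
  ++-congʳ v ≈-refl            = ≈-refl
  ++-congʳ v (≈-sym e)         = ≈-sym (++-congʳ v e)
  ++-congʳ v (≈-trans e e')    = ≈-trans (++-congʳ v e) (++-congʳ v e')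

  ++-congˡ : ∀ u {v v'} → v ≈ v' → u ++ v ≈ u ++ v'
  ++-congˡ u (≈-rel x r y R) = subst₂ _≈_ (++-assoc u x (r ++ y)) (++-assoc u x y) (≈-rel (u ++ x) r y R)
  ++-congˡ u ≈-refl          = ≈-refl
  ++-congˡ u (≈-sym e)       = ≈-sym (++-congˡ u e)
  ++-congˡ u (≈-trans e e')  = ≈-trans (++-congˡ u e) (++-congˡ u e')

  relator≈[] : ∀ {r} → Relator p q r → r ≈ []
  relator≈[] {r} R = subst₂ _≈_ (++-identityʳ r) refl (≈-rel [] r [] R)

  order : Gen → ℕ
  order 𝐚 = p
  order 𝐛 = q

  gen⁻¹ : Gen → Word
  gen⁻¹ x = replicate (pred (order x)) x

  ∷-gen⁻¹ : ∀ x → x ∷ gen⁻¹ x ≡ replicate (order x) x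
  ∷-gen⁻¹ 𝐚 = cong (λ k → replicate k 𝐚) (ℕ.suc-pred p)
  ∷-gen⁻¹ 𝐛 = cong (λ k → replicate k 𝐛) (ℕ.suc-pred q)

  replicate-order≈[] : ∀ x → replicate (order x) x ≈ []
  replicate-order≈[] 𝐚 = relator≈[] rel-a
  replicate-order≈[] 𝐛 = relator≈[] rel-b

  gen-inverseʳ : ∀ x → x ∷ gen⁻¹ x ≈ []
  gen-inverseʳ x = ≈-trans (≈-reflexive (∷-gen⁻¹ x)) (replicate-order≈[] x)

  gen-inverseˡ : ∀ x → gen⁻¹ x ++ [ x ] ≈ []
  gen-inverseˡ x = ≈-trans (≈-reflexive (replicate-∷ʳ _ x)) (gen-inverseʳ x)

  infix 8 _⁻¹
  _⁻¹ : Word → Word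
  []      ⁻¹ = []
  (x ∷ w) ⁻¹ = w ⁻¹ ++ gen⁻¹ x

  ++-inverseʳ : ∀ w → w ++ w ⁻¹ ≈ []
  ++-inverseʳ []      = ≈-refl
  ++-inverseʳ (x ∷ w) = begin
    x ∷ w ++ w ⁻¹ ++ gen⁻¹ x    ≡⟨ cong (x ∷_) (++-assoc w (w ⁻¹) (gen⁻¹ x)) ⟨
    x ∷ (w ++ w ⁻¹) ++ gen⁻¹ x  ≈⟨ ++-congˡ [ x ] (++-congʳ (gen⁻¹ x) (++-inverseʳ w)) ⟩
    x ∷ gen⁻¹ x                 ≈⟨ gen-inverseʳ x ⟩
    []                          ∎

  ++-inverseˡ : ∀ w → w ⁻¹ ++ w ≈ []
  ++-inverseˡ []      = ≈-refl
  ++-inverseˡ (x ∷ w) = begin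
    (w ⁻¹ ++ gen⁻¹ x) ++ x ∷ w    ≡⟨ ++-assoc (w ⁻¹) (gen⁻¹ x) (x ∷ w) ⟩
    w ⁻¹ ++ gen⁻¹ x ++ x ∷ w      ≡⟨ cong (w ⁻¹ ++_) (++-assoc (gen⁻¹ x) [ x ] w) ⟨
    w ⁻¹ ++ (gen⁻¹ x ++ [ x ]) ++ w ≈⟨ ++-congˡ (w ⁻¹) (++-congʳ w (gen-inverseˡ x)) ⟩
    w ⁻¹ ++ w                     ≈⟨ ++-inverseˡ w ⟩
    []                            ∎

  ⁻¹-++-cancelˡ : ∀ u v → u ⁻¹ ++ u ++ v ≈ v
  ⁻¹-++-cancelˡ u v = ≈-trans (≈-reflexive (sym (++-assoc (u ⁻¹) u v))) (++-congʳ v (++-inverseˡ u))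

  ++-⁻¹-cancelˡ : ∀ u v → u ++ u ⁻¹ ++ v ≈ v
  ++-⁻¹-cancelˡ u v = ≈-trans (≈-reflexive (sym (++-assoc u (u ⁻¹) v))) (++-congʳ v (++-inverseʳ u))

  ++-⁻¹-cancelʳ : ∀ u v → (u ++ v) ++ v ⁻¹ ≈ u
  ++-⁻¹-cancelʳ u v = begin
    (u ++ v) ++ v ⁻¹ ≡⟨ ++-assoc u v (v ⁻¹) ⟩
    u ++ v ++ v ⁻¹   ≈⟨ ++-congˡ u (++-inverseʳ v) ⟩
    u ++ []          ≡⟨ ++-identityʳ u ⟩
    u                ∎

  ++-cancelˡ : ∀ u {v w} → u ++ v ≈ u ++ w → v ≈ w
  ++-cancelˡ u {v} {w} e = begin
    v                ≈⟨ ⁻¹-++-cancelˡ u v ⟨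
    u ⁻¹ ++ u ++ v   ≈⟨ ++-congˡ (u ⁻¹) e ⟩
    u ⁻¹ ++ u ++ w   ≈⟨ ⁻¹-++-cancelˡ u w ⟩
    w                ∎

  ≈-solve-middle : ∀ u w v → [] ≈ u ++ w ++ v → w ≈ u ⁻¹ ++ v ⁻¹
  ≈-solve-middle u w v e = begin
    w                       ≈⟨ ⁻¹-++-cancelˡ u w ⟨
    u ⁻¹ ++ u ++ w          ≈⟨ ++-congˡ (u ⁻¹) (++-⁻¹-cancelʳ (u ++ w) v) ⟨
    u ⁻¹ ++ ((u ++ w) ++ v) ++ v ⁻¹ ≡⟨ cong (λ x → u ⁻¹ ++ x ++ v ⁻¹) (++-assoc u w v) ⟩
    u ⁻¹ ++ (u ++ w ++ v) ++ v ⁻¹   ≈⟨ ++-congˡ (u ⁻¹) (++-congʳ (v ⁻¹) e) ⟨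
    u ⁻¹ ++ v ⁻¹            ∎

  infix 9 𝐚^_
  𝐚^_ : ℕ → Word
  𝐚^ k = replicate k 𝐚

  𝐚^-+ : ∀ m n → 𝐚^ (m + n) ≡ 𝐚^ m ++ 𝐚^ n
  𝐚^-+ m n = replicate-+ m n 𝐚

  𝐚^-*p : ∀ c → 𝐚^ (c * p) ≈ []
  𝐚^-*p zero    = ≈-refl
  𝐚^-*p (suc c) = begin
    𝐚^ (p + c * p)      ≡⟨ 𝐚^-+ p (c * p) ⟩
    𝐚^ p ++ 𝐚^ (c * p)  ≈⟨ ++-congʳ (𝐚^ (c * p)) (replicate-order≈[] 𝐚) ⟩
    𝐚^ (c * p)          ≈⟨ 𝐚^-*p c ⟩
    []                  ∎

  𝐚^-% : ∀ k → 𝐚^ k ≈ 𝐚^ (k % p)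
  𝐚^-% k = begin
    𝐚^ k                          ≡⟨ cong 𝐚^_ (m≡m%n+[m/n]*n k p) ⟩
    𝐚^ (k % p + k / p * p)        ≡⟨ 𝐚^-+ (k % p) (k / p * p) ⟩
    𝐚^ (k % p) ++ 𝐚^ (k / p * p)  ≈⟨ ++-congˡ (𝐚^ (k % p)) (𝐚^-*p (k / p)) ⟩
    𝐚^ (k % p) ++ []              ≡⟨ ++-identityʳ (𝐚^ (k % p)) ⟩
    𝐚^ (k % p)                    ∎

  𝐚^-⁻¹ : ∀ k → (𝐚^ k) ⁻¹ ≡ 𝐚^ (k * pred p)
  𝐚^-⁻¹ zero    = refl
  𝐚^-⁻¹ (suc k) = trans (cong (_++ 𝐚^ pred p) (𝐚^-⁻¹ k))
    (trans (sym (𝐚^-+ (k * pred p) (pred p))) (cong 𝐚^_ (ℕ.+-comm (k * pred p) (pred p))))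

  𝐚𝐛 : Word
  𝐚𝐛 = 𝐚 ∷ 𝐛 ∷ []

  𝐚𝐛-involutive : ∀ u → (u ++ 𝐚𝐛) ++ 𝐚𝐛 ≈ u
  𝐚𝐛-involutive u = begin
    (u ++ 𝐚𝐛) ++ 𝐚𝐛  ≡⟨ ++-assoc u 𝐚𝐛 𝐚𝐛 ⟩
    u ++ 𝐚𝐛 ++ 𝐚𝐛    ≈⟨ ++-congˡ u (relator≈[] rel-ab) ⟩
    u ++ []          ≡⟨ ++-identityʳ u ⟩
    u                ∎

  sameTile-refl : ∀ g → SameTile p q g g
  sameTile-refl g = 0 , ≈-reflexive (sym (++-identityʳ g))

  sameTile-intro : ∀ g g' i j → g ++ 𝐚^ i ≈ g' ++ 𝐚^ j → SameTile p q g g'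
  sameTile-intro g g' i j e = i + j * pred p , (begin
    g'                              ≈⟨ ++-⁻¹-cancelʳ g' (𝐚^ j) ⟨
    (g' ++ 𝐚^ j) ++ (𝐚^ j) ⁻¹       ≈⟨ ++-congʳ ((𝐚^ j) ⁻¹) e ⟨
    (g ++ 𝐚^ i) ++ (𝐚^ j) ⁻¹        ≡⟨ cong ((g ++ 𝐚^ i) ++_) (𝐚^-⁻¹ j) ⟩
    (g ++ 𝐚^ i) ++ 𝐚^ (j * pred p)  ≡⟨ ++-assoc g (𝐚^ i) (𝐚^ (j * pred p)) ⟩
    g ++ 𝐚^ i ++ 𝐚^ (j * pred p)    ≡⟨ cong (g ++_) (𝐚^-+ i (j * pred p)) ⟨
    g ++ 𝐚^ (i + j * pred p)        ∎)

  sameTile-sym : ∀ {g g'} → SameTile p q g g' → SameTile p q g' g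
  sameTile-sym {g} {g'} (k , e) = sameTile-intro g' g 0 k (≈-trans (≈-reflexive (++-identityʳ g')) e)

  sameTile-trans : ∀ {g g' g''} → SameTile p q g g' → SameTile p q g' g'' → SameTile p q g g''
  sameTile-trans {g} {g'} {g''} (k , e) (l , e') = k + l , (begin
    g''                  ≈⟨ e' ⟩
    g' ++ 𝐚^ l           ≈⟨ ++-congʳ (𝐚^ l) e ⟩
    (g ++ 𝐚^ k) ++ 𝐚^ l  ≡⟨ ++-assoc g (𝐚^ k) (𝐚^ l) ⟩
    g ++ 𝐚^ k ++ 𝐚^ l    ≡⟨ cong (g ++_) (𝐚^-+ k l) ⟨
    g ++ 𝐚^ (k + l)      ∎)

  sameTile-% : ∀ {g g'} → SameTile p q g g' → ∃ λ k → k < p × g' ≈ g ++ 𝐚^ k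
  sameTile-% {g} (k , e) = k % p , m%n<n k p , ≈-trans e (++-congˡ g (𝐚^-% k))

  𝐛≈𝐚^⇒≈𝐚^ : ∀ {c} → [ 𝐛 ] ≈ 𝐚^ c → ∀ w → ∃ λ e → w ≈ 𝐚^ e
  𝐛≈𝐚^⇒≈𝐚^ 𝐛≈ [] = 0 , ≈-refl
  𝐛≈𝐚^⇒≈𝐚^ 𝐛≈ (𝐚 ∷ w) with 𝐛≈𝐚^⇒≈𝐚^ 𝐛≈ w
  ... | e , w≈ = suc e , ++-congˡ [ 𝐚 ] w≈
  𝐛≈𝐚^⇒≈𝐚^ {c} 𝐛≈ (𝐛 ∷ w) with 𝐛≈𝐚^⇒≈𝐚^ 𝐛≈ w
  ... | e , w≈ = c + e , ≈-trans (≈-trans (++-congʳ w 𝐛≈) (++-congˡ (𝐚^ c) w≈)) (≈-reflexive (sym (𝐚^-+ c e)))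

  𝐛≈𝐚^⇒sameTile : ∀ {c} → [ 𝐛 ] ≈ 𝐚^ c → ∀ g g' → SameTile p q g g'
  𝐛≈𝐚^⇒sameTile 𝐛≈ g g' with 𝐛≈𝐚^⇒≈𝐚^ 𝐛≈ (g ⁻¹ ++ g')
  ... | e , g⁻¹g'≈ = e , (begin
    g'             ≈⟨ ++-⁻¹-cancelˡ g g' ⟨
    g ++ g ⁻¹ ++ g' ≈⟨ ++-congˡ g g⁻¹g'≈ ⟩
    g ++ 𝐚^ e      ∎)

  across-sameTile⇒𝐛≈𝐚^ : ∀ g i → SameTile p q (edgeOf g i ++ 𝐚𝐛) g → ∃ λ c → [ 𝐛 ] ≈ 𝐚^ c
  across-sameTile⇒𝐛≈𝐚^ g i (k , e) = suc i * pred p + k * pred p , (begin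
    [ 𝐛 ]                                    ≈⟨ ≈-solve-middle (𝐚^ suc i) [ 𝐛 ] (𝐚^ k) (++-cancelˡ g g≈) ⟩
    (𝐚^ suc i) ⁻¹ ++ (𝐚^ k) ⁻¹               ≡⟨ cong₂ _++_ (𝐚^-⁻¹ (suc i)) (𝐚^-⁻¹ k) ⟩
    𝐚^ (suc i * pred p) ++ 𝐚^ (k * pred p)   ≡⟨ 𝐚^-+ (suc i * pred p) (k * pred p) ⟨
    𝐚^ (suc i * pred p + k * pred p)         ∎)
    where
    regroup : ((g ++ 𝐚^ i) ++ 𝐚𝐛) ++ 𝐚^ k ≡ g ++ 𝐚^ suc i ++ [ 𝐛 ] ++ 𝐚^ k
    regroup = trans (trans (++-assoc (g ++ 𝐚^ i) 𝐚𝐛 (𝐚^ k)) (++-assoc g (𝐚^ i) (𝐚 ∷ 𝐛 ∷ 𝐚^ k)))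
      (cong (g ++_) (trans (sym (++-assoc (𝐚^ i) [ 𝐚 ] (𝐛 ∷ 𝐚^ k))) (cong (_++ 𝐛 ∷ 𝐚^ k) (replicate-∷ʳ i 𝐚))))
    g≈ : g ++ [] ≈ g ++ 𝐚^ suc i ++ [ 𝐛 ] ++ 𝐚^ k
    g≈ = ≈-trans (≈-reflexive (++-identityʳ g)) (≈-trans e (≈-reflexive regroup))

  module _ (X : Polyform p q) where

    private
      tile : Fin (size X) → Tile
      tile = lookup (tiles X)

    distinct-lookup : ∀ {t t'} → t' ≢ t → ¬ SameTile p q (tile t) (tile t')
    distinct-lookup {t} {t'} t'≢t with Fin.<-cmp t t'
    ... | tri< t<t' _ _ = AllPairs-lookup (distinct X) t<t'
    ... | tri≈ _ t≡t' _ = ⊥-elim (t'≢t (sym t≡t'))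
    ... | tri> _ _ t'<t = AllPairs-lookup (distinct X) t'<t ∘ sameTile-sym

    Closed : Set
    Closed = ∀ t i → ¬ OnBoundary X t i

    Covered : Word → Set
    Covered w = ∃ λ t → SameTile p q (tile t) w

    Covered-resp : ∀ {w w'} → w ≈ w' → Covered w → Covered w'
    Covered-resp w≈w' (t , k , e) = t , k , ≈-trans (≈-sym w≈w') e

    Covered-∷ʳ𝐚 : ∀ {w} → Covered w → Covered (w ++ [ 𝐚 ])
    Covered-∷ʳ𝐚 (t , k , e) = t , suc k , ≈-trans (++-congʳ [ 𝐚 ] e)
      (≈-reflexive (trans (++-assoc (tile t) (𝐚^ k) [ 𝐚 ]) (cong (tile t ++_) (replicate-∷ʳ k 𝐚))))

    module _ (closed : Closed) where

      across-covered : ∀ t j → ¬ ¬ Covered (edgeOf (tile t) j ++ 𝐚𝐛)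
      across-covered t j ¬covered = closed t i λ t' t'≢t contains →
        ¬covered (Covered-resp (++-congʳ 𝐚𝐛 (≈-sym edge≈)) (neighbour t' t'≢t contains))
        where
        i : Fin p
        i = fromℕ< (m%n<n j p)
        edge≈ : edgeOf (tile t) j ≈ edgeOf (tile t) (toℕ i)
        edge≈ = ≈-trans (++-congˡ (tile t) (𝐚^-% j))
          (≈-reflexive (cong (λ k → tile t ++ 𝐚^ k) (sym (Fin.toℕ-fromℕ< (m%n<n j p)))))
        neighbour : ∀ t' → t' ≢ t → Contains p q (tile t') (edgeOf (tile t) (toℕ i)) →
                    Covered (edgeOf (tile t) (toℕ i) ++ 𝐚𝐛)
        neighbour t' t'≢t (l , _ , inj₁ e) = ⊥-elim (distinct-lookup t'≢t (sameTile-intro (tile t) (tile t') (toℕ i) l e))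
        neighbour t' _    (l , _ , inj₂ e) = t' , l , ≈-trans (++-congʳ 𝐚𝐛 e) (𝐚𝐛-involutive (tile t' ++ 𝐚^ l))

      Covered-∷ʳ : ∀ {w} → Covered w → ∀ x → ¬ ¬ Covered (w ++ [ x ])
      Covered-∷ʳ c 𝐚 = pure (Covered-∷ʳ𝐚 c)
      -- Appending 𝐛 means crossing side k + (p - 1) of the tile, since 𝐚^ pred p ++ [ 𝐚 ] ≈ [].
      Covered-∷ʳ {w} (t , k , w≈) 𝐛 = Covered-resp across≈ <$> across-covered t (k + pred p)
        where
        g : Tile
        g = tile t
        across≈ : (g ++ 𝐚^ (k + pred p)) ++ 𝐚𝐛 ≈ w ++ [ 𝐛 ]
        across≈ = begin
          (g ++ 𝐚^ (k + pred p)) ++ 𝐚𝐛                  ≡⟨ cong (λ x → (g ++ x) ++ 𝐚𝐛) (𝐚^-+ k (pred p)) ⟩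
          (g ++ 𝐚^ k ++ 𝐚^ pred p) ++ 𝐚𝐛                ≡⟨ cong (_++ 𝐚𝐛) (++-assoc g (𝐚^ k) (𝐚^ pred p)) ⟨
          ((g ++ 𝐚^ k) ++ 𝐚^ pred p) ++ 𝐚𝐛              ≡⟨ ++-assoc (g ++ 𝐚^ k) (𝐚^ pred p) 𝐚𝐛 ⟩
          (g ++ 𝐚^ k) ++ 𝐚^ pred p ++ 𝐚𝐛                ≡⟨ cong ((g ++ 𝐚^ k) ++_) (++-assoc (𝐚^ pred p) [ 𝐚 ] [ 𝐛 ]) ⟨
          (g ++ 𝐚^ k) ++ (𝐚^ pred p ++ [ 𝐚 ]) ++ [ 𝐛 ]  ≈⟨ ++-congˡ (g ++ 𝐚^ k) (++-congʳ [ 𝐛 ] (gen-inverseˡ 𝐚)) ⟩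
          (g ++ 𝐚^ k) ++ [ 𝐛 ]                          ≈⟨ ++-congʳ [ 𝐛 ] w≈ ⟨
          w ++ [ 𝐛 ]                                    ∎

      Covered-++ : ∀ {w} → Covered w → ∀ u → ¬ ¬ Covered (w ++ u)
      Covered-++ {w} c []      = pure (Covered-resp (≈-reflexive (sym (++-identityʳ w))) c)
      Covered-++ {w} c (x ∷ u) = do
        c' ← Covered-∷ʳ c x
        Covered-resp (≈-reflexive (++-assoc w [ x ] u)) <$> Covered-++ c' u

      covered : ∀ w → ¬ ¬ Covered w
      covered w = Covered-resp (++-⁻¹-cancelˡ (tile t₀) w) <$>
                  Covered-++ (t₀ , sameTile-refl (tile t₀)) (tile t₀ ⁻¹ ++ w)
        where
        t₀ : Fin (size X)
        t₀ = fromℕ< (nonempty X)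

      closed⇒size-maximal : (Z : Polyform p q) → ¬ size X < size Z
      closed⇒size-maximal Z X<Z = ¬¬-Π (λ z → covered (lookup (tiles Z) z)) λ cover →
        let z₁ , z₂ , z₁<z₂ , same = Fin.pigeonhole X<Z (proj₁ ∘ cover)
        in AllPairs-lookup (distinct Z) z₁<z₂
             (sameTile-trans (sameTile-sym (proj₂ (cover z₁)))
                             (subst (λ t → SameTile p q (tile t) (lookup (tiles Z) z₂)) (sym same) (proj₂ (cover z₂))))

    ¬¬-onBoundary : (Z : Polyform p q) → size X < size Z → ¬ ¬ (∃ λ t → ∃ λ i → OnBoundary X t i)
    ¬¬-onBoundary Z X<Z ¬onBoundary = closed⇒size-maximal (λ t i onBoundary → ¬onBoundary (t , i , onBoundary)) Z X<Z

  module Adjoin (X : Polyform p q) (2≤|X| : 2 ≤ size X)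
                (t : Fin (size X)) (i : Fin p) (boundary : OnBoundary X t i) where

    private
      tile : Fin (size X) → Tile
      tile = lookup (tiles X)

    edge : Word
    edge = edgeOf (tile t) (toℕ i)

    new : Tile
    new = edge ++ 𝐚𝐛

    new-contains-edge : Contains p q new edge
    new-contains-edge = 0 , >-nonZero⁻¹ p ,
      inj₂ (≈-sym (≈-trans (++-congʳ 𝐚𝐛 (≈-reflexive (++-identityʳ new))) (𝐚𝐛-involutive edge)))

    old-contains-new-edge : Contains p q (tile t) (edgeOf new 0)
    old-contains-new-edge = toℕ i , Fin.toℕ<n i , inj₂ (≈-reflexive (++-identityʳ new))

    new-∉ : ∀ t' → ¬ SameTile p q new (tile t')
    new-∉ t' same with t' Fin.≟ t
    ... | yes refl = AllPairs-¬⇒¬total {R = SameTile p q} (distinct X) 2≤|X|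
                       (𝐛≈𝐚^⇒sameTile (proj₂ (across-sameTile⇒𝐛≈𝐚^ (tile t) (toℕ i) same)))
    ... | no t'≢t with sameTile-% (sameTile-sym same)
    ...   | k , k<p , new≈ = boundary t' t'≢t
              (k , k<p , inj₂ (≈-trans (≈-sym (𝐚𝐛-involutive edge)) (++-congʳ 𝐚𝐛 new≈)))

    new⇝t : Reach p q (new ∷ tiles X) zero (suc t)
    new⇝t = reach-step reach-refl (0 , >-nonZero⁻¹ p , old-contains-new-edge)

    connected′ : ∀ s u → Reach p q (new ∷ tiles X) s u
    connected′ zero    zero    = reach-refl
    connected′ zero    (suc u) = Reach-trans new⇝t (Reach-∷ (connected X t u))
    connected′ (suc s) zero    = reach-step (Reach-∷ (connected X s t)) (toℕ i , Fin.toℕ<n i , new-contains-edge)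
    connected′ (suc s) (suc u) = Reach-∷ (connected X s u)

    adjoin : Polyform p q
    adjoin = record
      { tiles     = new ∷ tiles X
      ; nonempty  = s≤s z≤n
      ; distinct  = subst (All (¬_ ∘ SameTile p q new)) (tabulate-lookup (tiles X)) (tabulate⁺ new-∉) ∷ distinct X
      ; connected = connected′
      }

    adjoin-perimeter : ∀ {c c'} → HasPerimeter X c → HasPerimeter adjoin c' → c' + 2 ≤ p + c
    adjoin-perimeter (f , f⇔ , refl) (f' , f'⇔ , refl) =
      subst (_≤ p + countTrue f) (sym (trans (cong (_+ 2) (countTrue-suc f')) (regroup _ _)))
            (ℕ.+-mono-≤ new-row<p old-rows<)
      where
      regroup : ∀ a b → a + b + 2 ≡ suc a + suc b
      regroup = solve-∀
      0ᶠ : Fin p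
      0ᶠ = fromℕ< (>-nonZero⁻¹ p)
      new-row<p : count (f' zero) < p
      new-row<p = count-<-length (f' zero) 0ᶠ (false-of-¬ (f'⇔ zero 0ᶠ) λ onBoundary →
        onBoundary (suc t) (λ ())
          (subst (λ j → Contains p q (tile t) (edgeOf new j)) (sym (Fin.toℕ-fromℕ< _)) old-contains-new-edge))
      old-rows< : countTrue (f' ∘ suc) < countTrue f
      old-rows< = countTrue-mono-<
        (λ t' j f'≡true → Equivalence.from (f⇔ t' j) λ u u≢t' →
           Equivalence.to (f'⇔ (suc t') j) f'≡true (suc u) (u≢t' ∘ Fin.suc-injective))
        t i (false-of-¬ (f'⇔ (suc t) i) λ onBoundary → onBoundary zero (λ ()) new-contains-edge)
        (Equivalence.from (f⇔ t i) boundary)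

  ¬¬-adjoin : ∀ {c} (X : Polyform p q) → 2 ≤ size X → HasPerimeter X c → (Z : Polyform p q) → size X < size Z →
    ¬ ¬ (Σ (Polyform p q) λ Y → ∃ λ c' → size Y ≡ suc (size X) × HasPerimeter Y c' × c' + 2 ≤ p + c)
  ¬¬-adjoin X 2≤|X| hp Z X<Z = do
    t , i , boundary ← ¬¬-onBoundary X Z X<Z
    let open Adjoin X 2≤|X| t i boundary
    c' , hp' ← ¬¬-hasPerimeter adjoin
    pure (adjoin , c' , refl , hp' , adjoin-perimeter hp hp')

  ¬¬-grow : ∀ {c} (X : Polyform p q) → 2 ≤ size X → HasPerimeter X c → (Z : Polyform p q) →
    ∀ d → size X + d ≤ size Z →
    ¬ ¬ (Σ (Polyform p q) λ Y → ∃ λ c' → size Y ≡ size X + d × HasPerimeter Y c' × c' + d * 2 ≤ d * p + c)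
  ¬¬-grow X _ hp Z zero _ = pure (X , _ , sym (ℕ.+-identityʳ (size X)) , hp , ℕ.≤-reflexive (ℕ.+-identityʳ _))
  ¬¬-grow X 2≤|X| hp Z (suc d) X+1+d≤Z = do
    Y , c' , |Y| , hpY , c'-bound ← ¬¬-grow X 2≤|X| hp Z d (ℕ.<⇒≤ X+d<Z)
    Y' , c'' , |Y'| , hpY' , c''-bound ← ¬¬-adjoin Y (subst (2 ≤_) (sym |Y|) (ℕ.≤-trans 2≤|X| (ℕ.m≤m+n _ d))) hpY
                                                 Z (subst (_< size Z) (sym |Y|) X+d<Z)
    pure (Y' , c'' , trans |Y'| (trans (cong suc |Y|) (sym (ℕ.+-suc (size X) d))) , hpY' ,
          +2≤-accumulate p d c''-bound c'-bound)
    where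
    X+d<Z : size X + d < size Z
    X+d<Z = subst (_≤ size Z) (ℕ.+-suc (size X) d) X+1+d≤Z

  Pmin-growth : ∀ {N d Pm Pn} → 2 ≤ N → IsPmin p q N Pm → IsPmin p q (N + d) Pn → Pn + d * 2 ≤ d * p + Pm
  Pmin-growth {N} {d} {Pm} {Pn} 2≤N ((X , |X| , hpX) , _) ((Z , |Z| , _) , Pn-minimal) =
    decidable-stable (Pn + d * 2 ≤? d * p + Pm) λ ¬bound →
      ¬¬-grow X (subst (2 ≤_) (sym |X|) 2≤N) hpX Z d (ℕ.≤-reflexive (trans (cong (_+ d) |X|) (sym |Z|)))
        λ (Y , c , |Y| , hpY , c-bound) →
          ¬bound (ℕ.≤-trans (ℕ.+-monoˡ-≤ (d * 2) (Pn-minimal Y c (trans |Y| (cong (_+ d) |X|)) hpY)) c-bound)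

/-monoˡ-≤ : ∀ {i j} n .{{_ : NonZero n}} → i ℤ.≤ j → i ℚ./ n ≤ℚ j ℚ./ n
/-monoˡ-≤ {i} {j} (suc n) i≤j = ℚ.toℚᵘ-cancel-≤
  (ℚᵘ.≤-respˡ-≃ (ℚᵘ.≃-sym (ℚ.toℚᵘ-fromℚᵘ (mkℚᵘ i n)))
  (ℚᵘ.≤-respʳ-≃ (ℚᵘ.≃-sym (ℚ.toℚᵘ-fromℚᵘ (mkℚᵘ j n)))
    (*≤* (ℤ.*-monoʳ-≤-nonNeg (+ suc n) i≤j))))

+a-+b≤+c-+d : ∀ {a b c d} → a + d ≤ c + b → + a ℤ.- + b ℤ.≤ + c ℤ.- + d
+a-+b≤+c-+d {a} {b} {c} {d} a+d≤c+b = begin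
  + a ℤ.- + b                        ≡⟨ shift (+ a) (+ b) (+ d) ⟩
  (+ a ℤ.+ + d) ℤ.- (+ b ℤ.+ + d)    ≤⟨ ℤ.+-monoˡ-≤ (ℤ.- (+ b ℤ.+ + d)) (+≤+ a+d≤c+b) ⟩
  (+ c ℤ.+ + b) ℤ.- (+ b ℤ.+ + d)    ≡⟨ cancel (+ c) (+ b) (+ d) ⟩
  + c ℤ.- + d                        ∎
  where
  open ℤ.≤-Reasoning
  shift : ∀ x y w → x ℤ.- y ≡ (x ℤ.+ w) ℤ.- (y ℤ.+ w)
  shift = ℤ-solve-∀
  cancel : ∀ x y w → (x ℤ.+ y) ℤ.- (y ℤ.+ w) ≡ x ℤ.- w
  cancel = ℤ-solve-∀

M-mono : ∀ p (3≤p : 3 ≤ p) {m n Pm Pn} → m ≤ n → Pn + (n ∸ m) * 2 ≤ (n ∸ m) * p + Pm →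
  M p 3≤p m Pm ≤ℚ M p 3≤p n Pn
M-mono p 3≤p {m} {n} {Pm} {Pn} m≤n bound = /-monoˡ-≤ p {{>-nonZero (ℕ.≤-trans (s≤s z≤n) 3≤p)}}
  (+a-+b≤+c-+d {m * s + 2} {Pm} {n * s + 2} {Pn} (ℕ.≤-trans (ℕ.+-monoʳ-≤ (m * s + 2) Pn≤) (ℕ.≤-reflexive numerators)))
  where
  s k : ℕ
  s = p ∸ 2
  k = n ∸ m
  n≡m+k : n ≡ m + k
  n≡m+k = sym (ℕ.m+[n∸m]≡n m≤n)
  p≡s+2 : p ≡ s + 2
  p≡s+2 = sym (ℕ.m∸n+n≡m (ℕ.≤-trans (ℕ.n≤1+n 2) 3≤p))
  distribute : ∀ k s Pm → k * (s + 2) + Pm ≡ Pm + k * s + k * 2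
  distribute = solve-∀
  Pn≤ : Pn ≤ Pm + k * s
  Pn≤ = ℕ.+-cancelʳ-≤ (k * 2) Pn (Pm + k * s)
    (ℕ.≤-trans (subst (λ x → Pn + k * 2 ≤ k * x + Pm) p≡s+2 bound) (ℕ.≤-reflexive (distribute k s Pm)))
  regroup : ∀ m k s Pm → m * s + 2 + (Pm + k * s) ≡ (m + k) * s + 2 + Pm
  regroup = solve-∀
  numerators : m * s + 2 + (Pm + k * s) ≡ n * s + 2 + Pm
  numerators = trans (regroup m k s Pm) (cong (λ x → x * s + 2 + Pm) (sym n≡m+k))

lemma2p4 : (p q : ℕ) (3≤p : 3 ≤ p) → 3 ≤ q → 4 < (p ∸ 2) * (q ∸ 2) →
    (h : ℕ) → 1 ≤ h →
    (m n : ℕ) → 1 ≤ m → m ≤ n →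
    (Pm Pn : ℕ) → IsPmin p q (m + h) Pm → IsPmin p q (n + h) Pn →
    M p 3≤p m Pm ≤ℚ M p 3≤p n Pn
lemma2p4 p q 3≤p 3≤q _ h 1≤h m n 1≤m m≤n Pm Pn Pmin[m+h] Pmin[n+h] =
  M-mono p 3≤p m≤n (VonDyck.Pmin-growth p q (ℕ.+-mono-≤ 1≤m 1≤h) Pmin[m+h]
    (subst (λ N → IsPmin p q N Pn) (sym m+h+[n∸m]≡n+h) Pmin[n+h]))
  where
  instance
    p≢0 : NonZero p
    p≢0 = >-nonZero (ℕ.≤-trans (s≤s z≤n) 3≤p)
    q≢0 : NonZero q
    q≢0 = >-nonZero (ℕ.≤-trans (s≤s z≤n) 3≤q)
  m+h+[n∸m]≡n+h : m + h + (n ∸ m) ≡ n + h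
  m+h+[n∸m]≡n+h = trans (ℕ.+-assoc m h (n ∸ m)) (trans (cong (λ x → m + x) (ℕ.+-comm h (n ∸ m)))
    (trans (sym (ℕ.+-assoc m (n ∸ m) h)) (cong (_+ h) (ℕ.m+[n∸m]≡n m≤n))))
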